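{- For all $n\geq1$, $j_n(\{231,312\})=2^{\lfloor (n-1)/2\rfloor}$.
   Context: A permutation of a finite set $S$ of positive integers is a word in which each element of $S$ appears exactly once; $\mathfrak{S}_n$ is the set of permutations of $\{1,\dots,n\}$. For a permutation $\pi$ and a letter $x$ of $\pi$, $\rho_\pi(x)$ is the maximal consecutive subword of $\pi$ consisting of the letters immediately to the right of $x$ that are all larger than $x$. $\pi$ is Jacobi if $|\rho_\pi(x)|$ is even for all letters $x$. A permutation $\pi$ avoids a pattern $\sigma$ if no subword of $\pi$ has standardization (relative order) $\sigma$. For a set $\Pi$ of patterns, $j_n(\Pi)$ is the number of Jacobi permutations in $\mathfrak{S}_n$ avoiding every pattern in $\Pi$. -}

module Defs where

open import Data.Nat using (ℕ; zero; suc; _<_; _<?_; _+_)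
open import Data.Nat.Properties using ()
open import Data.Nat.Base using (_/_; _∸_; _^_)
open import Data.List using (List; []; _∷_; length; takeWhile; lookup)
open import Data.List.Relation.Binary.Sublist.Propositional using (_⊆_)
open import Data.Fin using (Fin; cast)
open import Data.Product using (_×_; Σ)
open import Data.Unit using (⊤)
open import Function.Bundles using (_⇔_)
open import Relation.Nullary using (¬_)
open import Relation.Binary.PropositionalEquality using (_≡_)

oneTo : ℕ → List ℕ
oneTo n = go n 1
  where
  go : ℕ → ℕ → List ℕ
  go zero    k = []
  go (suc m) k = k ∷ go m (suc k)

data Even : ℕ → Set where
  even-zero : Even zero
  even-ss   : ∀ {n} → Even n → Even (suc (suc n))

-- |ρ_π(x)| for π = x ∷ rest : length of the maximal run right after x of letters larger than x
ρlen : ℕ → List ℕ → ℕ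
ρlen x rest = length (takeWhile (x <?_) rest)

Jacobi : List ℕ → Set
Jacobi []         = ⊤
Jacobi (x ∷ rest) = Even (ρlen x rest) × Jacobi rest

OrderIso : List ℕ → List ℕ → Set
OrderIso w σ = Σ (length w ≡ length σ) λ eq →
  ∀ (i j : Fin (length w)) →
    (lookup w i < lookup w j) ⇔ (lookup σ (cast eq i) < lookup σ (cast eq j))

Contains : List ℕ → List ℕ → Set
Contains π σ = Σ (List ℕ) λ w → (w ⊆ π) × OrderIso w σ

Avoids : List ℕ → List ℕ → Set
Avoids π σ = ¬ Contains π σ

p231 : List ℕ
p231 = 2 ∷ 3 ∷ 1 ∷ []

p312 : List ℕ
p312 = 3 ∷ 1 ∷ 2 ∷ []

{-# OPTIONS --safe #-}
-- A permutation avoiding 231 and 312 is layered. After its maximum N it decreases (a rise x < y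
-- there would make N x y a 312), and every letter before N lies below N and below every letter
-- after N (otherwise t N s with s < t is a 231); so it is a permutation of 1..b followed by the
-- decreasing layer b+k, ..., b+1, and recursing on the prefix it is a concatenation of
-- decreasing runs of consecutive values. In a layered word ρ(x) is empty unless x ends its
-- layer, and then ρ(x) is everything after x; hence the word is Jacobi iff every layer except
-- the bottom one has even size. These layer compositions double from n to n + 2 (stack a new
-- layer of size 2 on top, or widen the top layer by 2), and there is one for n = 1 and n = 2.
module Submission where

open import Defs
open import Data.Nat using (ℕ; zero; suc; _+_; _∸_; _/_; _^_; _≤_; _<_; _≥_; _>_; _<ᵇ_; _<?_; z≤n; s≤s; z<s)
open import Data.Nat.Properties
open import Data.Nat.DivMod using (m/n≡1+[m∸n]/n)
open import Data.Nat.Induction using (<-wellFounded)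
open import Data.Nat.ListAction using (sum)
open import Induction.WellFounded using (Acc; acc)
open import Data.Bool using (true; false)
open import Data.Unit using (⊤; tt)
open import Data.Empty using (⊥-elim)
open import Data.Fin using (Fin; zero; suc; cast)
open import Data.Product using (_×_; Σ; _,_; proj₁; proj₂; ∃-syntax; ∃₂)
open import Data.Sum using (_⊎_; inj₁; inj₂)
import Data.Sum as Sum
open import Data.List using (List; []; _∷_; _++_; [_]; length; map; applyUpTo; applyDownFrom; lookup)
open import Data.List.Properties
  using (length-++; length-map; length-applyUpTo; length-applyDownFrom; applyUpTo-∷ʳ; map-applyUpTo;
         ++-identityʳ; ++-assoc; ++-cancelʳ; ++-conicalʳ; ∷ʳ-injectiveʳ; ∷-injectiveʳ)
open import Data.List.Membership.Propositional using (_∈_)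
open import Data.List.Membership.Propositional.Properties
  using (∈-++⁺ˡ; ∈-++⁺ʳ; ∈-++⁻; ∈-map⁺; ∈-map⁻; ∈-∃++; ∈-applyUpTo⁺)
open import Data.List.Relation.Unary.Any using (here; there)
open import Data.List.Relation.Unary.All as All using (All; []; _∷_)
open import Data.List.Relation.Unary.All.Properties using (applyUpTo⁺₁; applyDownFrom⁺₁) renaming (++⁺ to All-++⁺)
open import Data.List.Relation.Unary.AllPairs using (AllPairs; []; _∷_)
open import Data.List.Relation.Unary.AllPairs.Properties using () renaming (applyDownFrom⁺₁ to AllPairs-applyDownFrom⁺₁)
open import Data.List.Relation.Unary.Unique.Propositional using (Unique)
import Data.List.Relation.Unary.Unique.Propositional.Properties as Unique
open import Data.List.Relation.Binary.Permutation.Propositional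
  using (_↭_; ↭-refl; ↭-sym; ↭-prep; ↭⇒↭ₛ; module PermutationReasoning)
open import Data.List.Relation.Binary.Permutation.Propositional.Properties
  using (∈-resp-↭; All-resp-↭; ↭-length; shift; ∷↭∷ʳ; drop-mid; ↭-empty-inv)
import Data.List.Relation.Binary.Permutation.Setoid.Properties as PermutationSetoid
open import Data.List.Relation.Binary.Sublist.Propositional
  using (_⊆_; []; _∷_; _∷ʳ_; ⊆-refl; ⊆-trans; from∈; minimum)
import Data.List.Relation.Binary.Sublist.Propositional as Sublist
open import Data.List.Relation.Binary.Sublist.Propositional.Properties
  using (All-resp-⊆; ++⁺ˡ; ++⁺ʳ) renaming (++⁺ to ⊆-++⁺)
open import Function using (id; _∘_; const)
open import Function.Bundles using (_⇔_; mk⇔; Equivalence)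
open import Relation.Binary.Definitions using (tri<; tri≈; tri>)
open import Relation.Binary.PropositionalEquality
  using (_≡_; _≢_; refl; sym; trans; cong; cong₂; subst; subst₂; setoid; module ≡-Reasoning)
open import Relation.Nullary using (¬_; contradiction; yes; no)
open import Relation.Nullary.Decidable using (from-yes; from-no)

-- `oneTo` counts up with a helper local to its where-block, which cannot be named here.
-- `count` is a metavariable solved by unification with that helper (the with-abstraction
-- makes its arguments variables); its first argument is the unused parameter of `oneTo`.
mutual
  private
    count : ℕ → ℕ → ℕ → List ℕ
    count = _

    oneTo-unfold : ∀ n → oneTo (suc n) ≡ 1 ∷ count (suc n) n 2
    oneTo-unfold n with suc n | 2
    ... | _ | _ = refl

private
  count-suc : ∀ p q m k → count p m (suc k) ≡ map suc (count q m k)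
  count-suc p q zero k = refl
  count-suc p q (suc m) k = cong (suc k ∷_) (count-suc p q m (suc k))

oneTo-suc : ∀ n → oneTo (suc n) ≡ 1 ∷ map suc (oneTo n)
oneTo-suc n = trans (oneTo-unfold n) (cong (1 ∷_) (count-suc (suc n) n n 1))

oneTo≡applyUpTo : ∀ n → oneTo n ≡ applyUpTo suc n
oneTo≡applyUpTo zero = refl
oneTo≡applyUpTo (suc n) = begin
  oneTo (suc n)                  ≡⟨ oneTo-suc n ⟩
  1 ∷ map suc (oneTo n)          ≡⟨ cong (λ xs → 1 ∷ map suc xs) (oneTo≡applyUpTo n) ⟩
  1 ∷ map suc (applyUpTo suc n)  ≡⟨ cong (1 ∷_) (map-applyUpTo suc suc n) ⟩
  applyUpTo suc (suc n)          ∎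
  where open ≡-Reasoning

length-oneTo : ∀ n → length (oneTo n) ≡ n
length-oneTo n = trans (cong length (oneTo≡applyUpTo n)) (length-applyUpTo suc n)

oneTo-∷ʳ : ∀ n → oneTo (suc n) ≡ oneTo n ++ [ suc n ]
oneTo-∷ʳ n = begin
  oneTo (suc n)                 ≡⟨ oneTo≡applyUpTo (suc n) ⟩
  applyUpTo suc (suc n)         ≡⟨ applyUpTo-∷ʳ suc n ⟨
  applyUpTo suc n ++ [ suc n ]  ≡⟨ cong (_++ [ suc n ]) (oneTo≡applyUpTo n) ⟨
  oneTo n ++ [ suc n ]          ∎
  where open ≡-Reasoning

top∈oneTo : ∀ n → suc n ∈ oneTo (suc n)
top∈oneTo n = subst (suc n ∈_) (sym (oneTo≡applyUpTo (suc n))) (∈-applyUpTo⁺ suc ≤-refl)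

oneTo-bounded : ∀ n → All (_≤ n) (oneTo n)
oneTo-bounded n = subst (All (_≤ n)) (sym (oneTo≡applyUpTo n)) (applyUpTo⁺₁ suc n id)

oneTo-unique : ∀ n → Unique (oneTo n)
oneTo-unique n = subst Unique (sym (oneTo≡applyUpTo n))
  (Unique.applyUpTo⁺₁ suc n (λ i<j _ → <⇒≢ (s≤s i<j)))

module _ {n : ℕ} {π : List ℕ} (p : π ↭ oneTo n) where

  ↭oneTo⇒length : length π ≡ n
  ↭oneTo⇒length = trans (↭-length p) (length-oneTo n)

  ↭oneTo⇒bounded : All (_≤ n) π
  ↭oneTo⇒bounded = All-resp-↭ (↭-sym p) (oneTo-bounded n)

  ↭oneTo⇒unique : Unique π
  ↭oneTo⇒unique = PermutationSetoid.Unique-resp-↭ (setoid ℕ) (↭⇒↭ₛ (↭-sym p)) (oneTo-unique n)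

↭oneTo-max : ∀ {n π x} → π ↭ oneTo (suc n) → x ∈ π → All (_≤ x) π → x ≡ suc n
↭oneTo-max {n} p x∈π π≤x =
  ≤-antisym (All.lookup (↭oneTo⇒bounded p) x∈π) (All.lookup π≤x (∈-resp-↭ (↭-sym p) (top∈oneTo n)))

-- Layered permutations

layer : ℕ → ℕ → List ℕ
layer b = applyDownFrom (λ i → suc (b + i))

length-layer : ∀ b k → length (layer b k) ≡ k
length-layer b = length-applyDownFrom (λ i → suc (b + i))

layer-above : ∀ b k → All (b <_) (layer b k)
layer-above b k = applyDownFrom⁺₁ (λ i → suc (b + i)) k (λ {i} _ → s≤s (m≤m+n b i))

layer-decreasing : ∀ b k → AllPairs _>_ (layer b k)
layer-decreasing b k = AllPairs-applyDownFrom⁺₁ (λ i → suc (b + i)) k (λ j<i _ → s≤s (+-monoʳ-< b j<i))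

layer-∷ʳ : ∀ b k → layer b (suc k) ≡ layer (suc b) k ++ [ suc b ]
layer-∷ʳ b zero = cong (λ x → [ suc x ]) (+-identityʳ b)
layer-∷ʳ b (suc k) = cong₂ _∷_ (cong suc (+-suc b k)) (layer-∷ʳ b k)

++-layer-↭ : ∀ {τ} b k → τ ↭ oneTo b → τ ++ layer b k ↭ oneTo (b + k)
++-layer-↭ {τ} b zero p = subst₂ _↭_ (sym (++-identityʳ τ)) (cong oneTo (sym (+-identityʳ b))) p
++-layer-↭ {τ} b (suc k) p = begin
  τ ++ suc (b + k) ∷ layer b k      ↭⟨ shift (suc (b + k)) τ (layer b k) ⟩
  suc (b + k) ∷ (τ ++ layer b k)    ↭⟨ ↭-prep (suc (b + k)) (++-layer-↭ b k p) ⟩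
  suc (b + k) ∷ oneTo (b + k)       ↭⟨ ∷↭∷ʳ (suc (b + k)) (oneTo (b + k)) ⟩
  oneTo (b + k) ++ [ suc (b + k) ]  ≡⟨ oneTo-∷ʳ (b + k) ⟨
  oneTo (suc (b + k))               ≡⟨ cong oneTo (+-suc b k) ⟨
  oneTo (b + suc k)                 ∎
  where open PermutationReasoning

Below : List ℕ → List ℕ → Set
Below τ B = All (λ t → All (t <_) B) τ

Below-lookup : ∀ {τ B x y} → Below τ B → x ∈ τ → y ∈ B → x < y
Below-lookup τ<B x∈ y∈ = All.lookup (All.lookup τ<B x∈) y∈

↭oneTo⇒Below-layer : ∀ {τ b} k → τ ↭ oneTo b → Below τ (layer b k)
↭oneTo⇒Below-layer {b = b} k p = All.map (λ t≤b → All.map (≤-<-trans t≤b) (layer-above b k)) (↭oneTo⇒bounded p)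

-- A composition into layers is listed from the top layer down, a layer of size s being
-- recorded as s ∸ 1; so every list of naturals is a composition and `layered` is injective.
size : List ℕ → ℕ
size ks = sum (map suc ks)

layered : List ℕ → List ℕ
layered []       = []
layered (k ∷ ks) = layered ks ++ layer (size ks) (suc k)

layered-↭ : ∀ ks → layered ks ↭ oneTo (size ks)
layered-↭ [] = ↭-refl
layered-↭ (k ∷ ks) =
  subst (layered (k ∷ ks) ↭_) (cong oneTo (+-comm (size ks) (suc k))) (++-layer-↭ (size ks) (suc k) (layered-↭ ks))

length-layered : ∀ ks → length (layered ks) ≡ size ks
length-layered ks = ↭oneTo⇒length (layered-↭ ks)

layered-injective : ∀ {ks ls} → layered ks ≡ layered ls → ks ≡ ls
layered-injective {[]} {[]} _ = refl
layered-injective {[]} {l ∷ ls} eq with () ← ++-conicalʳ (layered ls) _ (sym eq)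
layered-injective {k ∷ ks} {[]} eq with () ← ++-conicalʳ (layered ks) _ eq
layered-injective {k ∷ ks} {l ∷ ls} eq = cong₂ _∷_ k≡l (layered-injective (++-cancelʳ _ _ _ eq′))
  where
  ++-layer-∷ʳ : ∀ xs b k → xs ++ layer b (suc k) ≡ (xs ++ layer (suc b) k) ++ [ suc b ]
  ++-layer-∷ʳ xs b k = trans (cong (xs ++_) (layer-∷ʳ b k)) (sym (++-assoc xs _ _))
  sizes : size ks ≡ size ls
  sizes = suc-injective (∷ʳ-injectiveʳ _ _
    (trans (sym (++-layer-∷ʳ (layered ks) (size ks) k)) (trans eq (++-layer-∷ʳ (layered ls) (size ls) l))))
  k≡l : k ≡ l
  k≡l = suc-injective (+-cancelʳ-≡ (size ks) (suc k) (suc l) (begin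
    suc k + size ks            ≡⟨ length-layered (k ∷ ks) ⟨
    length (layered (k ∷ ks))  ≡⟨ cong length eq ⟩
    length (layered (l ∷ ls))  ≡⟨ length-layered (l ∷ ls) ⟩
    suc l + size ls            ≡⟨ cong (suc l +_) sizes ⟨
    suc l + size ks            ∎))
    where open ≡-Reasoning
  eq′ : layered ks ++ layer (size ks) (suc k) ≡ layered ls ++ layer (size ks) (suc k)
  eq′ = subst₂ (λ b j → layered ks ++ layer (size ks) (suc k) ≡ layered ls ++ layer b (suc j))
               (sym sizes) (sym k≡l) eq

-- The Jacobi property

Even-+ : ∀ {m n} → Even m → Even n → Even (m + n)
Even-+ even-zero    en = en
Even-+ (even-ss em) en = even-ss (Even-+ em en)

Even-+-cancelˡ : ∀ {m n} → Even m → Even (m + n) → Even n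
Even-+-cancelˡ even-zero    e           = e
Even-+-cancelˡ (even-ss em) (even-ss e) = Even-+-cancelˡ em e

-- `ρlen x (y ∷ ys)` unfolds to a case split on `x <ᵇ y`.
ρlen-accept : ∀ {x y} ys → x < y → ρlen x (y ∷ ys) ≡ suc (ρlen x ys)
ρlen-accept {x} {y} ys x<y with x <ᵇ y | <⇒<ᵇ x<y
... | true | _ = refl

ρlen-reject : ∀ {x y} ys → ¬ x < y → ρlen x (y ∷ ys) ≡ 0
ρlen-reject {x} {y} ys x≮y with x <ᵇ y | <ᵇ⇒< x y
... | true  | x<y = contradiction (x<y _) x≮y
... | false | _   = refl

ρlen-all : ∀ {x B} → All (x <_) B → ρlen x B ≡ length B
ρlen-all []           = refl
ρlen-all (x<y ∷ x<B) = trans (ρlen-accept _ x<y) (cong suc (ρlen-all x<B))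

-- c is 0 when ρ(x) stops inside τ and length B when it runs through τ into B.
ρlen-++ : ∀ {x B} τ → All (x <_) B → Even (length B) → ∃[ c ] Even c × ρlen x (τ ++ B) ≡ ρlen x τ + c
ρlen-++ {B = B} [] x<B eB = length B , eB , ρlen-all x<B
ρlen-++ {x} {B} (y ∷ τ) x<B eB with x <? y
... | yes x<y = let c , ec , e = ρlen-++ τ x<B eB in
  c , ec , trans (ρlen-accept (τ ++ B) x<y) (trans (cong suc e) (cong (_+ c) (sym (ρlen-accept τ x<y))))
... | no x≮y = 0 , even-zero , trans (ρlen-reject (τ ++ B) x≮y) (sym (trans (+-identityʳ _) (ρlen-reject τ x≮y)))

ρlen-parity : ∀ {x B} τ → All (x <_) B → Even (length B) → Even (ρlen x (τ ++ B)) ⇔ Even (ρlen x τ)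
ρlen-parity τ x<B eB with c , ec , e ← ρlen-++ τ x<B eB =
  mk⇔ (λ ev → Even-+-cancelˡ ec (subst Even (+-comm _ c) (subst Even e ev)))
      (λ ev → subst Even (sym e) (Even-+ ev ec))

Jacobi-++⁻ : ∀ {τ B} → Below τ B → Jacobi (τ ++ B) → Jacobi τ × Jacobi B × (τ ≡ [] ⊎ Even (length B))
Jacobi-++⁻ {[]}    _            jB      = tt , jB , inj₁ refl
Jacobi-++⁻ {x ∷ τ} (x<B ∷ τ<B) (e , j) with Jacobi-++⁻ τ<B j
... | jτ , jB , inj₁ refl = (even-zero , tt) , jB , inj₂ (subst Even (ρlen-all x<B) e)
... | jτ , jB , inj₂ eB   = (Equivalence.to (ρlen-parity τ x<B eB) e , jτ) , jB , inj₂ eB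

Jacobi-++⁺ : ∀ {τ B} → Below τ B → Jacobi τ → Jacobi B → (τ ≡ [] ⊎ Even (length B)) → Jacobi (τ ++ B)
Jacobi-++⁺ {[]}    _            _        jB _         = jB
Jacobi-++⁺ {x ∷ τ} (x<B ∷ τ<B) (e , jτ) jB (inj₂ eB) =
  Equivalence.from (ρlen-parity τ x<B eB) e , Jacobi-++⁺ τ<B jτ jB (inj₂ eB)

Jacobi-decreasing : ∀ {xs} → AllPairs _>_ xs → Jacobi xs
Jacobi-decreasing []                  = tt
Jacobi-decreasing ([] ∷ ys)           = even-zero , Jacobi-decreasing ys
Jacobi-decreasing ((y<x ∷ _) ∷ ys)    =
  subst Even (sym (ρlen-reject _ (<-asym y<x))) even-zero , Jacobi-decreasing ys

JacobiShape : List ℕ → Set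
JacobiShape []       = ⊤
JacobiShape (k ∷ ks) = (ks ≡ [] ⊎ Even (suc k)) × JacobiShape ks

Jacobi-layered⁻ : ∀ ks → Jacobi (layered ks) → JacobiShape ks
Jacobi-layered⁻ []       _ = tt
Jacobi-layered⁻ (k ∷ ks) j =
  let jks , _ , c = Jacobi-++⁻ (↭oneTo⇒Below-layer (suc k) (layered-↭ ks)) j in
  Sum.map layered-injective (subst Even (length-layer (size ks) (suc k))) c , Jacobi-layered⁻ ks jks

Jacobi-layered⁺ : ∀ ks → JacobiShape ks → Jacobi (layered ks)
Jacobi-layered⁺ []       _       = tt
Jacobi-layered⁺ (k ∷ ks) (c , s) =
  Jacobi-++⁺ (↭oneTo⇒Below-layer (suc k) (layered-↭ ks)) (Jacobi-layered⁺ ks s)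
    (Jacobi-decreasing (layer-decreasing (size ks) (suc k)))
    (Sum.map (cong layered) (subst Even (sym (length-layer (size ks) (suc k)))) c)

-- Pattern containment

AllPairs-resp-⊇ : ∀ {R : ℕ → ℕ → Set} {xs ys} → xs ⊆ ys → AllPairs R ys → AllPairs R xs
AllPairs-resp-⊇ []          []         = []
AllPairs-resp-⊇ (_ ∷ʳ s)    (_ ∷ rs)   = AllPairs-resp-⊇ s rs
AllPairs-resp-⊇ (refl ∷ s)  (r ∷ rs)   = All-resp-⊆ s r ∷ AllPairs-resp-⊇ s rs

AllPairs-from-pairs : ∀ {R : ℕ → ℕ → Set} xs → (∀ {x y} → (x ∷ y ∷ []) ⊆ xs → R x y) → AllPairs R xs
AllPairs-from-pairs []       _ = []
AllPairs-from-pairs (x ∷ xs) r =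
  All.tabulate (λ y∈ → r (refl ∷ from∈ y∈)) ∷ AllPairs-from-pairs xs (λ s → r (x ∷ʳ s))

⊆-++-split : ∀ {w : List ℕ} xs {ys} → w ⊆ xs ++ ys →
             ∃₂ λ w₁ w₂ → w ≡ w₁ ++ w₂ × w₁ ⊆ xs × w₂ ⊆ ys
⊆-++-split {w} [] s = [] , w , refl , [] , s
⊆-++-split (x ∷ xs) (.x ∷ʳ s) with w₁ , w₂ , refl , s₁ , s₂ ← ⊆-++-split xs s =
  w₁ , w₂ , refl , x ∷ʳ s₁ , s₂
⊆-++-split (x ∷ xs) (refl ∷ s) with w₁ , w₂ , refl , s₁ , s₂ ← ⊆-++-split xs s =
  x ∷ w₁ , w₂ , refl , refl ∷ s₁ , s₂

⊆-++-descent : ∀ {τ B a b c} → Below τ B → (a ∷ b ∷ c ∷ []) ⊆ τ ++ B → c < a →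
               (a ∷ b ∷ c ∷ []) ⊆ τ ⊎ (a ∷ b ∷ c ∷ []) ⊆ B
⊆-++-descent {τ} τ<B s c<a with ⊆-++-split τ s
... | []             , _  , refl , _  , s₂ = inj₂ s₂
... | _ ∷ []         , _  , refl , s₁ , s₂ =
  ⊥-elim (<-asym c<a (Below-lookup τ<B (Sublist.lookup s₁ (here refl)) (Sublist.lookup s₂ (there (here refl)))))
... | _ ∷ _ ∷ []     , _  , refl , s₁ , s₂ =
  ⊥-elim (<-asym c<a (Below-lookup τ<B (Sublist.lookup s₁ (here refl)) (Sublist.lookup s₂ (here refl))))
... | _ ∷ _ ∷ _ ∷ [] , [] , refl , s₁ , _  = inj₁ s₁

Avoids-⊆ : ∀ {ρ π σ} → ρ ⊆ π → Avoids π σ → Avoids ρ σ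
Avoids-⊆ ρ⊆π av (w , w⊆ρ , iso) = av (w , ⊆-trans w⊆ρ ρ⊆π , iso)

Avoids-[] : ∀ {x σ} → Avoids [] (x ∷ σ)
Avoids-[] ([] , [] , () , _)

both : ∀ {P Q : Set} → P → Q → P ⇔ Q
both p q = mk⇔ (const q) (const p)

neither : ∀ {P Q : Set} → ¬ P → ¬ Q → P ⇔ Q
neither ¬p ¬q = mk⇔ (⊥-elim ∘ ¬p) (⊥-elim ∘ ¬q)

contains231⁺ : ∀ {π a b c} → (a ∷ b ∷ c ∷ []) ⊆ π → c < a → a < b → Contains π p231
contains231⁺ {a = a} {b} {c} s c<a a<b = a ∷ b ∷ c ∷ [] , s , refl , iso
  where
  w : List ℕ
  w = a ∷ b ∷ c ∷ []
  iso : (i j : Fin 3) → (lookup w i < lookup w j) ⇔ (lookup p231 (cast refl i) < lookup p231 (cast refl j))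
  iso zero             zero             = neither (<-irrefl refl) (<-irrefl refl)
  iso zero             (suc zero)       = both a<b (from-yes (2 <? 3))
  iso zero             (suc (suc zero)) = neither (<-asym c<a) (from-no (2 <? 1))
  iso (suc zero)       zero             = neither (<-asym a<b) (from-no (3 <? 2))
  iso (suc zero)       (suc zero)       = neither (<-irrefl refl) (<-irrefl refl)
  iso (suc zero)       (suc (suc zero)) = neither (<-asym (<-trans c<a a<b)) (from-no (3 <? 1))
  iso (suc (suc zero)) zero             = both c<a (from-yes (1 <? 2))
  iso (suc (suc zero)) (suc zero)       = both (<-trans c<a a<b) (from-yes (1 <? 3))
  iso (suc (suc zero)) (suc (suc zero)) = neither (<-irrefl refl) (<-irrefl refl)

contains231⁻ : ∀ {π} → Contains π p231 → ∃[ a ] ∃[ b ] ∃[ c ] (a ∷ b ∷ c ∷ []) ⊆ π × c < a × a < b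
contains231⁻ (a ∷ b ∷ c ∷ [] , s , refl , iso) =
  a , b , c , s , Equivalence.from (iso (suc (suc zero)) zero) (from-yes (1 <? 2)) ,
  Equivalence.from (iso zero (suc zero)) (from-yes (2 <? 3))

contains312⁺ : ∀ {π a b c} → (a ∷ b ∷ c ∷ []) ⊆ π → b < c → c < a → Contains π p312
contains312⁺ {a = a} {b} {c} s b<c c<a = a ∷ b ∷ c ∷ [] , s , refl , iso
  where
  w : List ℕ
  w = a ∷ b ∷ c ∷ []
  iso : (i j : Fin 3) → (lookup w i < lookup w j) ⇔ (lookup p312 (cast refl i) < lookup p312 (cast refl j))
  iso zero             zero             = neither (<-irrefl refl) (<-irrefl refl)
  iso zero             (suc zero)       = neither (<-asym (<-trans b<c c<a)) (from-no (3 <? 1))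
  iso zero             (suc (suc zero)) = neither (<-asym c<a) (from-no (3 <? 2))
  iso (suc zero)       zero             = both (<-trans b<c c<a) (from-yes (1 <? 3))
  iso (suc zero)       (suc zero)       = neither (<-irrefl refl) (<-irrefl refl)
  iso (suc zero)       (suc (suc zero)) = both b<c (from-yes (1 <? 2))
  iso (suc (suc zero)) zero             = both c<a (from-yes (2 <? 3))
  iso (suc (suc zero)) (suc zero)       = neither (<-asym b<c) (from-no (2 <? 1))
  iso (suc (suc zero)) (suc (suc zero)) = neither (<-irrefl refl) (<-irrefl refl)

contains312⁻ : ∀ {π} → Contains π p312 → ∃[ a ] ∃[ b ] ∃[ c ] (a ∷ b ∷ c ∷ []) ⊆ π × b < c × c < a
contains312⁻ (a ∷ b ∷ c ∷ [] , s , refl , iso) =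
  a , b , c , s , Equivalence.from (iso (suc zero) (suc (suc zero))) (from-yes (1 <? 2)) ,
  Equivalence.from (iso (suc (suc zero)) zero) (from-yes (2 <? 3))

++-decreasing-avoids231 : ∀ {τ B} → Below τ B → AllPairs _>_ B → Avoids τ p231 → Avoids (τ ++ B) p231
++-decreasing-avoids231 τ<B dec av occ with a , b , c , s , c<a , a<b ← contains231⁻ occ
  with ⊆-++-descent τ<B s c<a
... | inj₁ s₁ = av (contains231⁺ s₁ c<a a<b)
... | inj₂ s₂ with (b<a ∷ _) ∷ _ ← AllPairs-resp-⊇ s₂ dec = <-asym a<b b<a

++-decreasing-avoids312 : ∀ {τ B} → Below τ B → AllPairs _>_ B → Avoids τ p312 → Avoids (τ ++ B) p312
++-decreasing-avoids312 τ<B dec av occ with a , b , c , s , b<c , c<a ← contains312⁻ occ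
  with ⊆-++-descent τ<B s c<a
... | inj₁ s₁ = av (contains312⁺ s₁ b<c c<a)
... | inj₂ s₂ with _ ∷ (c<b ∷ _) ∷ _ ← AllPairs-resp-⊇ s₂ dec = <-asym b<c c<b

layered-avoids231 : ∀ ks → Avoids (layered ks) p231
layered-avoids231 []       = Avoids-[]
layered-avoids231 (k ∷ ks) =
  ++-decreasing-avoids231 (↭oneTo⇒Below-layer (suc k) (layered-↭ ks)) (layer-decreasing (size ks) (suc k))
    (layered-avoids231 ks)

layered-avoids312 : ∀ ks → Avoids (layered ks) p312
layered-avoids312 []       = Avoids-[]
layered-avoids312 (k ∷ ks) =
  ++-decreasing-avoids312 (↭oneTo⇒Below-layer (suc k) (layered-↭ ks)) (layer-decreasing (size ks) (suc k))
    (layered-avoids312 ks)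

-- Structure of 231,312-avoiders

around-maximum : ∀ {τ N σ} → Unique (τ ++ N ∷ σ) → All (_≤ N) (τ ++ N ∷ σ) →
                 Avoids (τ ++ N ∷ σ) p231 → Avoids (τ ++ N ∷ σ) p312 →
                 AllPairs _>_ (N ∷ σ) × Below τ (N ∷ σ)
around-maximum {τ} {N} {σ} u ≤N av231 av312 =
  (All.tabulate σ<N ∷ AllPairs-from-pairs σ σ-decreasing) ,
  All.tabulate (λ t∈ → τ<N t∈ ∷ All.tabulate (τ<σ t∈))
  where
  distinct : ∀ {x y} → (x ∷ y ∷ []) ⊆ τ ++ N ∷ σ → x ≢ y
  distinct s with (x≢y ∷ []) ∷ _ ← AllPairs-resp-⊇ s u = x≢y
  σ<N : ∀ {y} → y ∈ σ → y < N
  σ<N y∈ = ≤∧≢⇒< (All.lookup ≤N (∈-++⁺ʳ τ (there y∈))) (distinct (++⁺ˡ τ (refl ∷ from∈ y∈)) ∘ sym)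
  τ<N : ∀ {t} → t ∈ τ → t < N
  τ<N t∈ = ≤∧≢⇒< (All.lookup ≤N (∈-++⁺ˡ t∈)) (distinct (⊆-++⁺ (from∈ t∈) (refl ∷ minimum σ)))
  σ-decreasing : ∀ {x y} → (x ∷ y ∷ []) ⊆ σ → x > y
  σ-decreasing {x} {y} s with <-cmp x y
  ... | tri< x<y _ _ =
    contradiction (contains312⁺ (++⁺ˡ τ (refl ∷ s)) x<y (σ<N (Sublist.lookup s (there (here refl))))) av312
  ... | tri≈ _ x≡y _ = contradiction x≡y (distinct (++⁺ˡ τ (N ∷ʳ s)))
  ... | tri> _ _ y<x = y<x
  τ<σ : ∀ {t s} → t ∈ τ → s ∈ σ → t < s
  τ<σ {t} {s} t∈ s∈ with <-cmp t s
  ... | tri< t<s _ _ = t<s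
  ... | tri≈ _ t≡s _ = contradiction t≡s (distinct (⊆-++⁺ (from∈ t∈) (N ∷ʳ from∈ s∈)))
  ... | tri> _ _ s<t = contradiction (contains231⁺ (⊆-++⁺ (from∈ t∈) (refl ∷ from∈ s∈)) s<t (τ<N t∈)) av231

decreasing-suffix-layer : ∀ {τ} b σ → τ ++ σ ↭ oneTo (b + length σ) → AllPairs _>_ σ → Below τ σ →
                          σ ≡ layer b (length σ) × τ ↭ oneTo b
decreasing-suffix-layer {τ} b [] p _ _ = refl , subst₂ _↭_ (++-identityʳ τ) (cong oneTo (+-identityʳ b)) p
decreasing-suffix-layer {τ} b (s ∷ σ) p (s>σ ∷ dec) τ<sσ = cong₂ _∷_ s≡max (proj₁ ih) , proj₂ ih
  where
  m : ℕ
  m = b + length σ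
  p′ : τ ++ s ∷ σ ↭ oneTo (suc m)
  p′ = subst (λ n → τ ++ s ∷ σ ↭ oneTo n) (+-suc b (length σ)) p
  s≡max : s ≡ suc m
  s≡max = ↭oneTo-max p′ (∈-++⁺ʳ τ (here refl))
            (All-++⁺ (All.map (<⇒≤ ∘ All.head) τ<sσ) (≤-refl ∷ All.map <⇒≤ s>σ))
  p″ : τ ++ [ s ] ++ σ ↭ oneTo m ++ [ s ] ++ []
  p″ = subst (λ x → τ ++ s ∷ σ ↭ oneTo m ++ [ x ]) (sym s≡max) (subst (τ ++ s ∷ σ ↭_) (oneTo-∷ʳ m) p′)
  ih : σ ≡ layer b (length σ) × τ ↭ oneTo b
  ih = decreasing-suffix-layer b σ (subst (τ ++ σ ↭_) (++-identityʳ (oneTo m)) (drop-mid τ (oneTo m) p″))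
         dec (All.map All.tail τ<sσ)

avoider-split : ∀ {n π} → π ↭ oneTo (suc n) → Avoids π p231 → Avoids π p312 →
             ∃₂ λ τ k → π ≡ τ ++ layer (length τ) (suc k) × τ ↭ oneTo (length τ) × length τ < suc n
avoider-split {n} p av231 av312 with τ , σ , refl ← ∈-∃++ (∈-resp-↭ (↭-sym p) (top∈oneTo n)) =
  τ , length σ , cong (τ ++_) (proj₁ top) , proj₂ top , subst (length τ <_) lengths (m<m+n (length τ) z<s)
  where
  lengths : length τ + suc (length σ) ≡ suc n
  lengths = trans (sym (length-++ τ)) (↭oneTo⇒length p)
  shape : AllPairs _>_ (suc n ∷ σ) × Below τ (suc n ∷ σ)
  shape = around-maximum (↭oneTo⇒unique p) (↭oneTo⇒bounded p) av231 av312
  top : suc n ∷ σ ≡ layer (length τ) (suc (length σ)) × τ ↭ oneTo (length τ)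
  top = decreasing-suffix-layer (length τ) (suc n ∷ σ) (subst (λ m → τ ++ suc n ∷ σ ↭ oneTo m) (sym lengths) p)
          (proj₁ shape) (proj₂ shape)

layered-complete : ∀ {n π} → π ↭ oneTo n → Avoids π p231 → Avoids π p312 → ∃[ ks ] π ≡ layered ks
layered-complete {n} = complete (<-wellFounded n)
  where
  complete : ∀ {n π} → Acc _<_ n → π ↭ oneTo n → Avoids π p231 → Avoids π p312 → ∃[ ks ] π ≡ layered ks
  complete {zero}  _        p _     _     = [] , ↭-empty-inv p
  complete {suc n} (acc rs) p av231 av312 with τ , k , refl , pτ , τ<n ← avoider-split p av231 av312
    with ks , refl ← complete (rs τ<n) pτ (Avoids-⊆ (++⁺ʳ _ ⊆-refl) av231) (Avoids-⊆ (++⁺ʳ _ ⊆-refl) av312)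
    = k ∷ ks , cong (λ b → layered ks ++ layer b (suc k)) (length-layered ks)

-- Counting layer compositions

stack : List ℕ → List ℕ
stack ks = 1 ∷ ks

widen : List ℕ → List ℕ
widen []       = []
widen (k ∷ ks) = suc (suc k) ∷ ks

shapes : ℕ → List (List ℕ)
shapes 0                   = [ [] ]
shapes 1                   = [ [ 0 ] ]
shapes 2                   = [ [ 1 ] ]
shapes (suc (suc (suc n))) = map stack (shapes (suc n)) ++ map widen (shapes (suc n))

stack-sound : ∀ {n ls} → JacobiShape ls × size ls ≡ suc n → JacobiShape (stack ls) × size (stack ls) ≡ 3 + n
stack-sound (s , e) = (inj₂ (even-ss even-zero) , s) , cong (2 +_) e

widen-sound : ∀ {n} ls → JacobiShape ls × size ls ≡ suc n → JacobiShape (widen ls) × size (widen ls) ≡ 3 + n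
widen-sound []       (_ , ())
widen-sound (l ∷ ls) ((c , s) , e) = (Sum.map₂ even-ss c , s) , cong (2 +_) e

step-sound : ∀ {n ks} → (∀ {ls} → ls ∈ shapes (suc n) → JacobiShape ls × size ls ≡ suc n) →
             ks ∈ shapes (3 + n) → JacobiShape ks × size ks ≡ 3 + n
step-sound {n} ih ks∈ with ∈-++⁻ (map stack (shapes (suc n))) ks∈
... | inj₁ ∈stack  with ls , ls∈ , refl ← ∈-map⁻ stack ∈stack  = stack-sound (ih ls∈)
... | inj₂ ∈widen with ls , ls∈ , refl ← ∈-map⁻ widen ∈widen = widen-sound ls (ih ls∈)

shapes-sound : ∀ n {ks} → ks ∈ shapes n → JacobiShape ks × size ks ≡ n
shapes-sound 0                   (here refl) = tt , refl
shapes-sound 1                   (here refl) = (inj₁ refl , tt) , refl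
shapes-sound 2                   (here refl) = (inj₁ refl , tt) , refl
shapes-sound (suc (suc (suc n))) ks∈         = step-sound (shapes-sound (suc n)) ks∈

∷-∈-shapes : ∀ k {ls} → (ls ≡ [] ⊎ Even (suc k)) → ls ∈ shapes (size ls) →
             (k ∷ ls) ∈ shapes (size (k ∷ ls))
∷-∈-shapes 0 (inj₁ refl) _ = here refl
∷-∈-shapes 1 (inj₁ refl) _ = here refl
∷-∈-shapes 1 {[]} (inj₂ _) _ = here refl
∷-∈-shapes 1 {_ ∷ _} (inj₂ _) ls∈ = ∈-++⁺ˡ (∈-map⁺ stack ls∈)
∷-∈-shapes (suc (suc k)) {ls} c ls∈ =
  ∈-++⁺ʳ (map stack (shapes (suc (k + size ls))))
    (∈-map⁺ widen (∷-∈-shapes k (Sum.map₂ (λ { (even-ss e) → e }) c) ls∈))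

shapes-complete : ∀ ks → JacobiShape ks → ks ∈ shapes (size ks)
shapes-complete []       _       = here refl
shapes-complete (k ∷ ks) (c , s) = ∷-∈-shapes k c (shapes-complete ks s)

shapes-unique : ∀ n → Unique (shapes n)
shapes-unique 0 = [] ∷ []
shapes-unique 1 = [] ∷ []
shapes-unique 2 = [] ∷ []
shapes-unique (suc (suc (suc n))) =
  Unique.++⁺ (Unique.map⁺ ∷-injectiveʳ (shapes-unique (suc n)))
             (Unique.map⁺ widen-injective (shapes-unique (suc n)))
             disjoint
  where
  widen-injective : ∀ {ks ls} → widen ks ≡ widen ls → ks ≡ ls
  widen-injective {[]}    {[]}    _    = refl
  widen-injective {_ ∷ _} {_ ∷ _} refl = refl
  stack≢widen : ∀ ks ls → stack ks ≢ widen ls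
  stack≢widen _ []      ()
  stack≢widen _ (_ ∷ _) ()
  disjoint : ∀ {v} → ¬ (v ∈ map stack (shapes (suc n)) × v ∈ map widen (shapes (suc n)))
  disjoint (∈stack , ∈widen)
    with ks , _ , refl ← ∈-map⁻ stack ∈stack
    with ls , _ , e ← ∈-map⁻ widen ∈widen =
    stack≢widen ks ls e

length-shapes : ∀ n → length (shapes n) ≡ 2 ^ ((n ∸ 1) / 2)
length-shapes 0 = refl
length-shapes 1 = refl
length-shapes 2 = refl
length-shapes (suc (suc (suc n))) = begin
  length (map stack xs ++ map widen xs)         ≡⟨ length-++ (map stack xs) ⟩
  length (map stack xs) + length (map widen xs) ≡⟨ cong₂ _+_ (length-map stack xs) (length-map widen xs) ⟩
  length xs + length xs                           ≡⟨ cong (λ l → l + l) (length-shapes (suc n)) ⟩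
  2 ^ (n / 2) + 2 ^ (n / 2)                       ≡⟨ cong (2 ^ (n / 2) +_) (+-identityʳ (2 ^ (n / 2))) ⟨
  2 ^ suc (n / 2)                                 ≡⟨ cong (2 ^_) (m/n≡1+[m∸n]/n {2 + n} {2} (s≤s (s≤s z≤n))) ⟨
  2 ^ ((2 + n) / 2)                               ∎
  where
  open ≡-Reasoning
  xs : List (List ℕ)
  xs = shapes (suc n)

JacobiAvoider : ℕ → List ℕ → Set
JacobiAvoider n π = (π ↭ oneTo n) × Jacobi π × Avoids π p231 × Avoids π p312

layered-shapes-sound : ∀ {n π} → π ∈ map layered (shapes n) → JacobiAvoider n π
layered-shapes-sound {n} π∈ with ks , ks∈ , refl ← ∈-map⁻ layered π∈ with s , refl ← shapes-sound n ks∈ =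
  layered-↭ ks , Jacobi-layered⁺ ks s , layered-avoids231 ks , layered-avoids312 ks

layered-shapes-complete : ∀ {n π} → JacobiAvoider n π → π ∈ map layered (shapes n)
layered-shapes-complete (p , j , av231 , av312) with ks , refl ← layered-complete p av231 av312 =
  ∈-map⁺ layered (subst (λ m → ks ∈ shapes m) (trans (sym (length-layered ks)) (↭oneTo⇒length p))
                        (shapes-complete ks (Jacobi-layered⁻ ks j)))

theorem8p7 : (n : ℕ) → n ≥ 1 →
    Σ (List (List ℕ)) λ L →
      Unique L ×
      (∀ (π : List ℕ) → (π ∈ L) ⇔ ((π ↭ oneTo n) × Jacobi π × Avoids π p231 × Avoids π p312)) ×
      (length L ≡ 2 ^ ((n ∸ 1) / 2))
theorem8p7 n _ =
  map layered (shapes n) ,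
  Unique.map⁺ layered-injective (shapes-unique n) ,
  (λ _ → mk⇔ layered-shapes-sound layered-shapes-complete) ,
  trans (length-map layered (shapes n)) (length-shapes n)
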